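{- Let $p\ge 5$ be prime, and let $t\ge 0$ be an integer. Define the graph $G_p$ as follows: (a) if $p=12t+1$, then $G_p=3t\,C_9[K_{6t}]$, which has $\frac98(p-1)^2$ vertices; (b) if $p=12t+5$, then $G_p=(3t+1)\,C_9[K_{6t+2}]$, which has $\frac98(p-1)^2$ vertices; (c) if $p=12t+7$, then $G_p=C_5[K_{6t+3}]\sqcup(3t+1)\,C_9[K_{6t+3}]$, which has $\frac18(p-1)(9p-7)$ vertices; (d) if $p=12t+11$, then $G_p=C_4[K_{6t+5}]\sqcup(3t+2)\,C_9[K_{6t+5}]$, which has $\frac18(p-1)(9p-11)$ vertices. Then $G_p$ has no induced regular subgraph with exactly $p$ vertices.
   Context: $C_r$ is the cycle on $r$ vertices and $K_s$ the complete graph on $s$ vertices. The lexicographic product $C_r[K_s]$ is the graph obtained from $C_r$ by replacing each vertex $i$ by a clique of order $s$, with every vertex of the clique for $i$ joined to every vertex of the clique for $j$ whenever $ij$ is an edge of $C_r$. For a graph $F$ and a positive integer $m$, $mF$ denotes the disjoint union of $m$ copies of $F$, and $\sqcup$ denotes disjoint union of graphs. -}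

module Defs where

open import Data.Empty using (⊥)
open import Data.Nat using (ℕ; zero; suc; _+_; _*_; _%_; NonZero)
open import Data.Fin using (Fin; toℕ)
open import Data.Fin.Properties renaming (_≟_ to _≟ᶠ_)
open import Data.Nat.Properties using () renaming (_≟_ to _≟ⁿ_)
open import Data.Product using (Σ; _×_; _,_)
open import Data.Sum using (_⊎_; inj₁; inj₂)
open import Data.List using (List; length; filter)
open import Data.List.Membership.Propositional using (_∈_)
open import Data.List.Relation.Unary.Unique.Propositional using (Unique)
open import Relation.Nullary using (¬_; Dec; yes; no)
open import Relation.Nullary.Decidable using (_⊎-dec_; _×-dec_; ¬?)
open import Relation.Binary.PropositionalEquality using (_≡_)

record Graph : Set₁ where
  field
    V    : Set
    Adj  : V → V → Set
    adj? : ∀ u v → Dec (Adj u v)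
open Graph public

CycleAdj : (r : ℕ) → .{{NonZero r}} → Fin r → Fin r → Set
CycleAdj r i j = (toℕ j ≡ (toℕ i + 1) % r) ⊎ (toℕ i ≡ (toℕ j + 1) % r)

cycleAdj? : (r : ℕ) → .{{_ : NonZero r}} → ∀ i j → Dec (CycleAdj r i j)
cycleAdj? r i j = (toℕ j ≟ⁿ (toℕ i + 1) % r) ⊎-dec (toℕ i ≟ⁿ (toℕ j + 1) % r)

CK : (r s : ℕ) → .{{NonZero r}} → Graph
CK r s = record
  { V    = Fin r × Fin s
  ; Adj  = λ { (i , a) (j , b) → ((i ≡ j) × ¬ (a ≡ b)) ⊎ CycleAdj r i j }
  ; adj? = λ { (i , a) (j , b) → ((i ≟ᶠ j) ×-dec ¬? (a ≟ᶠ b)) ⊎-dec cycleAdj? r i j }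
  }

_⊔_ : Graph → Graph → Graph
G ⊔ H = record
  { V    = V G ⊎ V H
  ; Adj  = λ { (inj₁ u) (inj₁ v) → Adj G u v
             ; (inj₂ u) (inj₂ v) → Adj H u v
             ; _ _ → ⊥ }
  ; adj? = λ { (inj₁ u) (inj₁ v) → adj? G u v
             ; (inj₂ u) (inj₂ v) → adj? H u v
             ; (inj₁ _) (inj₂ _) → no (λ ())
             ; (inj₂ _) (inj₁ _) → no (λ ()) }
  }

copies : ℕ → Graph → Graph
copies m F = record
  { V    = Fin m × V F
  ; Adj  = λ { (k , u) (l , v) → (k ≡ l) × Adj F u v }
  ; adj? = λ { (k , u) (l , v) → (k ≟ᶠ l) ×-dec adj? F u v }
  }

degIn : (G : Graph) → List (V G) → V G → ℕ
degIn G S v = length (filter (adj? G v) S)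

HasInducedRegularSubgraph : Graph → ℕ → Set
HasInducedRegularSubgraph G n =
  Σ (List (V G)) λ S → Unique S × (length S ≡ n) ×
    Σ ℕ (λ d → ∀ v → v ∈ S → degIn G S v ≡ d)

-- Let S induce a d-regular subgraph on p vertices and let x b be the number of vertices of S in
-- the clique b.  A vertex of S in b is adjacent to the other x b − 1 vertices of S in b and to
-- all of S in the cliques next to b, so every occupied clique satisfies
-- x (b − 1) + x b + x (b + 1) = D with D = d + 1, and x b ≤ s.  On a cycle with an empty clique
-- the occupied cliques form at most ⌊r/2⌋ runs of one or two cliques, each of weight D ≤ 2s;
-- on a cycle without empty clique the equations add up to 3 Σ x = r D, so a saturated C₉
-- contributes 3D.  Hence p = m D where m is at most 4 per C₉ plus 2 for a C₅ or C₄, which is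
-- p − 1 in every case, and m = 1 would give D ≤ 2s = p − 1: both contradict primality.  What
-- remains is a saturated C₅ or C₄; since 3 ∤ r this forces D = 3c and p = (r + 3M) c, hence
-- p = r + 3M, which the residue of p modulo 3 rules out.
module Submission where

open import Defs
open import Data.Empty using (⊥; ⊥-elim)
open import Data.Fin using (Fin; toℕ)
open import Data.Fin.Properties using (toℕ-injective; toℕ-fromℕ<; fromℕ<-cong; toℕ<n; all?; any?) renaming (_≟_ to _≟ᶠ_)
open import Data.List using (List; []; _∷_; _++_; applyUpTo; length; filter; map; allFin; cartesianProduct)
open import Data.List.Membership.Propositional using (_∈_; _∉_)
open import Data.List.Membership.Propositional.Properties using (∈-filter⁻; ∈-allFin; ∈-map⁺; ∈-map⁻; ∈-++⁺ˡ; ∈-++⁺ʳ; ∈-cartesianProduct⁺)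
open import Data.List.Properties using (filter-≐; filter-all; filter-some; length-tabulate; map-∘; map-++; map-applyUpTo)
import Data.List.Relation.Unary.All as All
open import Data.List.Relation.Unary.AllPairs using (_∷_)
open import Data.List.Relation.Unary.Any using (here; there)
open import Data.List.Relation.Unary.Unique.Propositional using (Unique)
import Data.List.Relation.Unary.Unique.Propositional.Properties as Unique
open import Data.Nat using (ℕ; zero; suc; _+_; _*_; _∸_; _%_; _≤_; _<_; s≤s; z≤n; ⌊_/2⌋; NonZero)
open import Data.Nat.DivMod using (_mod_; m%n<n; m<n⇒m%n≡m; [m+n]%n≡m%n; [m+kn]%n≡m%n; %-distribˡ-+; m%n%n≡m%n)
open import Data.Nat.Divisibility using (_∣_; _∣?_; divides)
open import Data.Nat.ListAction using (sum)
open import Data.Nat.ListAction.Properties using (sum-++)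
open import Data.Nat.Primality using (Prime; prime?; prime⇒irreducible; prime⇒nonZero; euclidsLemma)
open import Data.Nat.Properties
open import Algebra.Properties.CommutativeSemigroup +-commutativeSemigroup using (x∙yz≈y∙xz)
open import Data.Nat.Tactic.RingSolver using (solve-∀)
open import Data.Product as Product using (_×_; _,_; proj₁; proj₂; ∃; ∃₂)
import Data.Product.Properties as ×
open import Data.Sum as Sum using (_⊎_; inj₁; inj₂; [_,_]; [_,_]′)
import Data.Sum.Properties as ⊎
open import Function using (id; _∘_; _⇔_; Equivalence; mk⇔)
open import Level using (0ℓ)
open import Relation.Binary.Definitions using (DecidableEquality)
open import Relation.Binary.PropositionalEquality using (_≡_; _≢_; refl; sym; trans; cong; cong₂; subst; subst₂; module ≡-Reasoning)
open import Relation.Nullary using (¬_; Dec; yes; no)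
open import Relation.Nullary.Decidable using (_×-dec_; _→-dec_; ¬?; map′; toWitness; toWitnessFalse)
open import Relation.Unary using (Pred; Decidable; _≐_)
open import Relation.Unary.Properties using (_∪?_)

-- Counting in lists

module _ {A : Set} where

  count : {P : Pred A 0ℓ} → Decidable P → List A → ℕ
  count P? xs = length (filter P? xs)

  module _ {P : Pred A 0ℓ} (P? : Decidable P) where

    count-none : ∀ xs → (∀ {x} → x ∈ xs → ¬ P x) → count P? xs ≡ 0
    count-none []       _    = refl
    count-none (x ∷ xs) none with P? x
    ... | yes px = ⊥-elim (none (here refl) px)
    ... | no _   = count-none xs (none ∘ there)

    count-all : ∀ xs → (∀ x → P x) → count P? xs ≡ length xs
    count-all xs all = cong length (filter-all P? (All.universal all xs))

    count≤1 : ∀ {xs} → Unique xs → (∀ {x y} → x ∈ xs → y ∈ xs → P x → P y → x ≡ y) → count P? xs ≤ 1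
    count≤1 {[]}     _             _    = z≤n
    count≤1 {x ∷ xs} (x∉xs ∷ uniq) same with P? x
    ... | yes px = s≤s (≤-reflexive (count-none xs λ y∈xs py → All.lookup x∉xs y∈xs (same (here refl) (there y∈xs) px py)))
    ... | no _   = count≤1 uniq (λ x∈ y∈ → same (there x∈) (there y∈))

    count-witness : ∀ xs → 0 < count P? xs → ∃ λ x → x ∈ xs × P x
    count-witness (x ∷ xs) pos with P? x
    ... | yes px = x , here refl , px
    ... | no _   with count-witness xs pos
    ...   | y , y∈xs , py = y , there y∈xs , py

  count-≐ : {P Q : Pred A 0ℓ} (P? : Decidable P) (Q? : Decidable Q) → P ≐ Q → ∀ xs → count P? xs ≡ count Q? xs
  count-≐ P? Q? P≐Q xs = cong length (filter-≐ P? Q? P≐Q xs)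

  count-∪ : {P Q : Pred A 0ℓ} (P? : Decidable P) (Q? : Decidable Q) → (∀ {x} → P x → Q x → ⊥) →
            ∀ xs → count (P? ∪? Q?) xs ≡ count P? xs + count Q? xs
  count-∪ P? Q? disjoint []       = refl
  count-∪ P? Q? disjoint (x ∷ xs) with P? x | Q? x | count-∪ P? Q? disjoint xs
  ... | yes p | yes q | _  = ⊥-elim (disjoint p q)
  ... | yes _ | no _  | ih = cong suc ih
  ... | no _  | yes _ | ih = trans (cong suc ih) (sym (+-suc _ _))
  ... | no _  | no _  | ih = ih

  module _ (_≟_ : DecidableEquality A) where

    count-self : ∀ {x xs} → Unique xs → x ∈ xs → count (x ≟_) xs ≡ 1
    count-self {x} uniq x∈xs =
      ≤-antisym (count≤1 (x ≟_) uniq λ _ _ → λ { refl refl → refl }) (filter-some (x ≟_) x∈xs)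

  module _ {B : Set} (_≟_ : DecidableEquality B) (f : A → B) where
    open import Data.List.Membership.DecPropositional _≟_ using (_∈?_)

    count-fibres : ∀ {bs} → Unique bs → ∀ xs →
                   count (λ x → f x ∈? bs) xs ≡ sum (map (λ b → count (λ x → f x ≟ b) xs) bs)
    count-fibres {[]}     _             xs = count-none (λ x → f x ∈? []) xs λ _ ()
    count-fibres {b ∷ bs} (b∉bs ∷ uniq) xs = begin
      count (λ x → f x ∈? b ∷ bs) xs
        ≡⟨ count-≐ _ ((λ x → f x ≟ b) ∪? (λ x → f x ∈? bs)) (split , join) xs ⟩
      count ((λ x → f x ≟ b) ∪? (λ x → f x ∈? bs)) xs
        ≡⟨ count-∪ (λ x → f x ≟ b) (λ x → f x ∈? bs) (λ { refl fx∈bs → All.lookup b∉bs fx∈bs refl }) xs ⟩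
      count (λ x → f x ≟ b) xs + count (λ x → f x ∈? bs) xs
        ≡⟨ cong (count (λ x → f x ≟ b) xs +_) (count-fibres uniq xs) ⟩
      count (λ x → f x ≟ b) xs + sum (map (λ c → count (λ x → f x ≟ c) xs) bs) ∎
      where
      open ≡-Reasoning
      split : ∀ {x} → f x ∈ b ∷ bs → f x ≡ b ⊎ f x ∈ bs
      split (here e)  = inj₁ e
      split (there m) = inj₂ m
      join : ∀ {x} → f x ≡ b ⊎ f x ∈ bs → f x ∈ b ∷ bs
      join (inj₁ e) = here e
      join (inj₂ m) = there m

    length-fibres : ∀ {bs} → Unique bs → (∀ x → f x ∈ bs) → ∀ xs →
                    length xs ≡ sum (map (λ b → count (λ x → f x ≟ b) xs) bs)
    length-fibres uniq complete xs =
      trans (sym (count-all (λ x → f x ∈? _) xs complete)) (count-fibres uniq xs)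

sum≤length : {A : Set} (f : A → ℕ) → (∀ x → f x ≤ 1) → ∀ xs → sum (map f xs) ≤ length xs
sum≤length f ≤1 []       = z≤n
sum≤length f ≤1 (x ∷ xs) = +-mono-≤ (≤1 x) (sum≤length f ≤1 xs)

-- Blow-ups of graphs by cliques

-- G is an induced subgraph of H[K_s], where H has vertex set Block and adjacency given by
-- `neighbours`; `block` and `slot` locate a vertex by its clique and its position in it.
record Blowup (s : ℕ) (G : Graph) : Set₁ where
  field
    Block                : Set
    _≟ᴮ_                 : DecidableEquality Block
    _≟ⱽ_                 : DecidableEquality (V G)
    block                : V G → Block
    slot                 : V G → Fin s
    block-slot-injective : ∀ {u v} → block u ≡ block v → slot u ≡ slot v → u ≡ v
    neighbours           : Block → List Block
    neighbours-unique    : ∀ b → Unique (neighbours b)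
    ∉-neighbours         : ∀ b → b ∉ neighbours b
    blocks               : List Block
    blocks-unique        : Unique blocks
    ∈-blocks             : ∀ b → b ∈ blocks
    adj⇔                 : ∀ u v → Adj G u v ⇔ ((block v ≡ block u × v ≢ u) ⊎ block v ∈ neighbours (block u))

  total : (Block → ℕ) → ℕ
  total x = sum (map x blocks)

  Balanced : ℕ → (Block → ℕ) → Set
  Balanced D x = ∀ b → x b ≡ 0 ⊎ x b + sum (map x (neighbours b)) ≡ D

module Occupancy {s G} (B : Blowup s G) {S : List (V G)} (S-unique : Unique S) where
  open Blowup B
  open import Data.List.Membership.DecPropositional _≟ᴮ_ using (_∈?_)

  occupancy : Block → ℕ
  occupancy b = count (λ v → block v ≟ᴮ b) S

  size≡total : length S ≡ total occupancy
  size≡total = length-fibres _≟ᴮ_ block blocks-unique (∈-blocks ∘ block) S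

  occupancy≤ : ∀ b → occupancy b ≤ s
  occupancy≤ b = begin
    occupancy b
      ≡⟨ length-fibres _≟ᶠ_ slot (Unique.allFin⁺ s) (∈-allFin ∘ slot) Sᵇ ⟩
    sum (map (λ a → count (λ v → slot v ≟ᶠ a) Sᵇ) (allFin s))
      ≤⟨ sum≤length _ (λ a → count≤1 _ Sᵇ-unique same-slot) (allFin s) ⟩
    length (allFin s)
      ≡⟨ length-tabulate id ⟩
    s ∎
    where
    open ≤-Reasoning
    Sᵇ = filter (λ v → block v ≟ᴮ b) S
    Sᵇ-unique : Unique Sᵇ
    Sᵇ-unique = Unique.filter⁺ (λ v → block v ≟ᴮ b) S-unique
    in-block : ∀ {v} → v ∈ Sᵇ → block v ≡ b
    in-block v∈ = proj₂ (∈-filter⁻ (λ v → block v ≟ᴮ b) {xs = S} v∈)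
    same-slot : ∀ {a u v} → u ∈ Sᵇ → v ∈ Sᵇ → slot u ≡ a → slot v ≡ a → u ≡ v
    same-slot u∈ v∈ refl eq = block-slot-injective (trans (in-block u∈) (sym (in-block v∈))) (sym eq)

  degree+1 : ∀ {v} → v ∈ S → suc (degIn G S v) ≡ occupancy (block v) + sum (map occupancy (neighbours (block v)))
  degree+1 {v} v∈S = begin
    suc (degIn G S v)
      ≡⟨ cong suc (count-≐ (adj? G v) (same? ∪? near?) (Equivalence.to (adj⇔ v _) , Equivalence.from (adj⇔ v _)) S) ⟩
    suc (count (same? ∪? near?) S)
      ≡⟨ cong suc (count-∪ same? near? (λ (same-block , _) → ∉-neighbours (block v) ∘ subst (_∈ near) same-block) S) ⟩
    suc (count same? S) + count near? S
      ≡⟨ cong₂ _+_ (sym occupancy-own) (count-fibres _≟ᴮ_ block (neighbours-unique (block v)) S) ⟩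
    occupancy (block v) + sum (map occupancy (neighbours (block v))) ∎
    where
    open ≡-Reasoning
    same? : Decidable (λ w → block w ≡ block v × w ≢ v)
    same? w = (block w ≟ᴮ block v) ×-dec ¬? (w ≟ⱽ v)
    near : List Block
    near = neighbours (block v)
    near? : Decidable (λ w → block w ∈ near)
    near? w = block w ∈? near
    self-or-same : ∀ {w} → block w ≡ block v → v ≡ w ⊎ (block w ≡ block v × w ≢ v)
    self-or-same {w} eq with w ≟ⱽ v
    ... | yes refl = inj₁ refl
    ... | no w≢v   = inj₂ (eq , w≢v)
    block-of : ∀ {w} → v ≡ w ⊎ (block w ≡ block v × w ≢ v) → block w ≡ block v
    block-of (inj₁ refl)     = refl
    block-of (inj₂ (eq , _)) = eq
    occupancy-own : occupancy (block v) ≡ suc (count same? S)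
    occupancy-own = begin
      occupancy (block v)
        ≡⟨ count-≐ _ ((v ≟ⱽ_) ∪? same?) (self-or-same , block-of) S ⟩
      count ((v ≟ⱽ_) ∪? same?) S
        ≡⟨ count-∪ (v ≟ⱽ_) same? (λ { refl (_ , v≢v) → v≢v refl }) S ⟩
      count (v ≟ⱽ_) S + count same? S
        ≡⟨ cong (_+ count same? S) (count-self _≟ⱽ_ S-unique v∈S) ⟩
      suc (count same? S) ∎

  balanced : ∀ d → (∀ v → v ∈ S → degIn G S v ≡ d) → Balanced (suc d) occupancy
  balanced d regular b with occupancy b ≟ 0
  ... | yes empty = inj₁ empty
  ... | no nonempty with count-witness (λ v → block v ≟ᴮ b) S (n≢0⇒n>0 nonempty)
  ...   | v , v∈S , refl = inj₂ (trans (sym (degree+1 v∈S)) (cong suc (regular v v∈S)))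

Admits : ∀ {s G} → Blowup s G → (ℕ → ℕ → Set) → Set
Admits {s} B Φ = ∀ D (x : Block → ℕ) → (∀ b → x b ≤ s) → Balanced D x → Φ D (total x)
  where open Blowup B

regular-size : ∀ {s G Φ n} (B : Blowup s G) → Admits B Φ → HasInducedRegularSubgraph G n → ∃ λ D → Φ D n
regular-size {Φ = Φ} B admits (S , S-unique , |S|≡n , d , regular) =
  suc d , subst (Φ (suc d)) (trans (sym size≡total) |S|≡n) (admits (suc d) occupancy occupancy≤ (balanced d regular))
  where open Occupancy B S-unique

sum-map-∘ : {A B : Set} (g : B → ℕ) (f : A → B) (xs : List A) → sum (map g (map f xs)) ≡ sum (map (g ∘ f) xs)
sum-map-∘ g f xs = cong sum (sym (map-∘ xs))

balanced-∘ : {A B : Set} {D : ℕ} (x : B → ℕ) (f : A → B) (N : A → List A) →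
             (∀ a → x (f a) ≡ 0 ⊎ x (f a) + sum (map x (map f (N a))) ≡ D) →
             ∀ a → x (f a) ≡ 0 ⊎ x (f a) + sum (map (x ∘ f) (N a)) ≡ D
balanced-∘ x f N balanced a = Sum.map₂ (trans (cong (x (f a) +_) (sym (sum-map-∘ x f (N a))))) (balanced a)

∈-map-,⁻ : {A B : Set} {k l : A} {c : B} {cs : List B} → (l , c) ∈ map (k ,_) cs → l ≡ k × c ∈ cs
∈-map-,⁻ l,c∈ with ∈-map⁻ _ l,c∈
... | c , c∈cs , refl = refl , c∈cs

lift-adj⇔ : {U U′ X X′ A : Set} {ιᵤ : U → U′} {ιₓ : X → X′} →
            (∀ {u v} → ιᵤ u ≡ ιᵤ v → u ≡ v) → (∀ {a b} → ιₓ a ≡ ιₓ b → a ≡ b) →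
            ∀ {u v a b N} → A ⇔ ((b ≡ a × v ≢ u) ⊎ b ∈ N) →
            A ⇔ ((ιₓ b ≡ ιₓ a × ιᵤ v ≢ ιᵤ u) ⊎ ιₓ b ∈ map ιₓ N)
lift-adj⇔ {ιᵤ = ιᵤ} {ιₓ} ιᵤ-injective ιₓ-injective A⇔ = mk⇔
  (Sum.map (Product.map (cong ιₓ) (_∘ ιᵤ-injective)) (∈-map⁺ ιₓ) ∘ Equivalence.to A⇔)
  (Equivalence.from A⇔ ∘ Sum.map (Product.map ιₓ-injective (_∘ cong ιᵤ)) unmap)
  where
  unmap : ∀ {b N} → ιₓ b ∈ map ιₓ N → b ∈ N
  unmap ιb∈ with ∈-map⁻ ιₓ ιb∈
  ... | _ , b′∈N , eq = subst (_∈ _) (sym (ιₓ-injective eq)) b′∈N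

copies-blowup : ∀ {s G} m → Blowup s G → Blowup s (copies m G)
copies-blowup {s} {G} m B = record
  { Block                = Fin m × Block
  ; _≟ᴮ_                 = ×.≡-dec _≟ᶠ_ _≟ᴮ_
  ; _≟ⱽ_                 = ×.≡-dec _≟ᶠ_ _≟ⱽ_
  ; block                = λ (k , u) → k , block u
  ; slot                 = slot ∘ proj₂
  ; block-slot-injective = injective
  ; neighbours           = λ (k , b) → map (k ,_) (neighbours b)
  ; neighbours-unique    = λ (k , b) → Unique.map⁺ ×.,-injectiveʳ (neighbours-unique b)
  ; ∉-neighbours         = λ (k , b) → ∉-neighbours b ∘ proj₂ ∘ ∈-map-,⁻
  ; blocks               = cartesianProduct (allFin m) blocks
  ; blocks-unique        = Unique.cartesianProduct⁺ (Unique.allFin⁺ m) blocks-unique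
  ; ∈-blocks             = λ (k , b) → ∈-cartesianProduct⁺ (∈-allFin k) (∈-blocks b)
  ; adj⇔                 = copy-adj⇔
  }
  where
  open Blowup B
  injective : ∀ {ku lv : Fin m × V G} → (proj₁ ku , block (proj₂ ku)) ≡ (proj₁ lv , block (proj₂ lv)) →
              slot (proj₂ ku) ≡ slot (proj₂ lv) → ku ≡ lv
  injective {k , u} {l , v} eq same-slot with ×.,-injective eq
  ... | refl , same-block = cong (k ,_) (block-slot-injective same-block same-slot)
  copy-adj⇔ : ∀ ku lv → Adj (copies m G) ku lv ⇔
          (((proj₁ lv , block (proj₂ lv)) ≡ (proj₁ ku , block (proj₂ ku)) × lv ≢ ku) ⊎
           (proj₁ lv , block (proj₂ lv)) ∈ map (proj₁ ku ,_) (neighbours (block (proj₂ ku))))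
  copy-adj⇔ (k , u) (l , v) with k ≟ᶠ l
  ... | yes refl = mk⇔ (Equivalence.to lifted ∘ proj₂) ((refl ,_) ∘ Equivalence.from lifted)
    where lifted = lift-adj⇔ {ιᵤ = k ,_} {ιₓ = k ,_} ×.,-injectiveʳ ×.,-injectiveʳ (adj⇔ u v)
  ... | no k≢l   = mk⇔ (⊥-elim ∘ k≢l ∘ proj₁) (⊥-elim ∘ k≢l ∘ sym ∘ [ ×.,-injectiveˡ ∘ proj₁ , proj₁ ∘ ∈-map-,⁻ ])

⊔-blowup : ∀ {s G H} → Blowup s G → Blowup s H → Blowup s (G ⊔ H)
⊔-blowup {s} {G} {H} B C = record
  { Block                = B.Block ⊎ C.Block
  ; _≟ᴮ_                 = ⊎.≡-dec B._≟ᴮ_ C._≟ᴮ_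
  ; _≟ⱽ_                 = ⊎.≡-dec B._≟ⱽ_ C._≟ⱽ_
  ; block                = block
  ; slot                 = [ B.slot , C.slot ]
  ; block-slot-injective = injective
  ; neighbours           = neighbours
  ; neighbours-unique    = [ Unique.map⁺ ⊎.inj₁-injective ∘ B.neighbours-unique
                           , Unique.map⁺ ⊎.inj₂-injective ∘ C.neighbours-unique ]
  ; ∉-neighbours         = irreflexive
  ; blocks               = map inj₁ B.blocks ++ map inj₂ C.blocks
  ; blocks-unique        = Unique.++⁺ (Unique.map⁺ ⊎.inj₁-injective B.blocks-unique)
                                      (Unique.map⁺ ⊎.inj₂-injective C.blocks-unique) disjoint
  ; ∈-blocks             = [ ∈-++⁺ˡ ∘ ∈-map⁺ inj₁ ∘ B.∈-blocks , ∈-++⁺ʳ _ ∘ ∈-map⁺ inj₂ ∘ C.∈-blocks ]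
  ; adj⇔                 = adj⇔
  }
  where
  module B = Blowup B
  module C = Blowup C
  block : V G ⊎ V H → B.Block ⊎ C.Block
  block = Sum.map B.block C.block
  neighbours : B.Block ⊎ C.Block → List (B.Block ⊎ C.Block)
  neighbours = [ map inj₁ ∘ B.neighbours , map inj₂ ∘ C.neighbours ]
  injective : ∀ {u v} → block u ≡ block v → [ B.slot , C.slot ] u ≡ [ B.slot , C.slot ] v → u ≡ v
  injective {inj₁ u} {inj₁ v} eq same-slot = cong inj₁ (B.block-slot-injective (⊎.inj₁-injective eq) same-slot)
  injective {inj₂ u} {inj₂ v} eq same-slot = cong inj₂ (C.block-slot-injective (⊎.inj₂-injective eq) same-slot)
  irreflexive : ∀ b → b ∉ neighbours b
  irreflexive (inj₁ b) b∈ with ∈-map⁻ inj₁ b∈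
  ... | _ , b∈′ , refl = B.∉-neighbours b b∈′
  irreflexive (inj₂ b) b∈ with ∈-map⁻ inj₂ b∈
  ... | _ , b∈′ , refl = C.∉-neighbours b b∈′
  disjoint : ∀ {b} → ¬ (b ∈ map inj₁ B.blocks × b ∈ map inj₂ C.blocks)
  disjoint (b∈₁ , b∈₂) with ∈-map⁻ inj₁ b∈₁ | ∈-map⁻ inj₂ b∈₂
  ... | _ , _ , refl | _ , _ , ()
  inj₁∉map-inj₂ : ∀ {b} {N : List C.Block} → ¬ (inj₁ b ∈ map inj₂ N)
  inj₁∉map-inj₂ b∈ with ∈-map⁻ inj₂ b∈
  ... | _ , _ , ()
  inj₂∉map-inj₁ : ∀ {b} {N : List B.Block} → ¬ (inj₂ b ∈ map inj₁ N)
  inj₂∉map-inj₁ b∈ with ∈-map⁻ inj₁ b∈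
  ... | _ , _ , ()
  adj⇔ : ∀ u v → Adj (G ⊔ H) u v ⇔ ((block v ≡ block u × v ≢ u) ⊎ block v ∈ neighbours (block u))
  adj⇔ (inj₁ u) (inj₁ v) = lift-adj⇔ ⊎.inj₁-injective ⊎.inj₁-injective (B.adj⇔ u v)
  adj⇔ (inj₂ u) (inj₂ v) = lift-adj⇔ ⊎.inj₂-injective ⊎.inj₂-injective (C.adj⇔ u v)
  adj⇔ (inj₁ u) (inj₂ v) = mk⇔ (λ ()) λ { (inj₁ (() , _)) ; (inj₂ v∈) → ⊥-elim (inj₂∉map-inj₁ v∈) }
  adj⇔ (inj₂ u) (inj₁ v) = mk⇔ (λ ()) λ { (inj₁ (() , _)) ; (inj₂ v∈) → ⊥-elim (inj₁∉map-inj₂ v∈) }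

sum-cartesianProduct : {A B : Set} (f : A × B → ℕ) (as : List A) (bs : List B) →
                       sum (map f (cartesianProduct as bs)) ≡ sum (map (λ a → sum (map (f ∘ (a ,_)) bs)) as)
sum-cartesianProduct f []       bs = refl
sum-cartesianProduct f (a ∷ as) bs = begin
  sum (map f (map (a ,_) bs ++ cartesianProduct as bs))
    ≡⟨ cong sum (map-++ f (map (a ,_) bs) (cartesianProduct as bs)) ⟩
  sum (map f (map (a ,_) bs) ++ map f (cartesianProduct as bs))
    ≡⟨ sum-++ (map f (map (a ,_) bs)) (map f (cartesianProduct as bs)) ⟩
  sum (map f (map (a ,_) bs)) + sum (map f (cartesianProduct as bs))
    ≡⟨ cong₂ _+_ (sum-map-∘ f (a ,_) bs) (sum-cartesianProduct f as bs) ⟩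
  sum (map (f ∘ (a ,_)) bs) + sum (map (λ a → sum (map (f ∘ (a ,_)) bs)) as) ∎
  where open ≡-Reasoning

-- A run occupies one or two cliques, so its weight is at most s + s; a saturated C₉ is
-- counted as three runs of three cliques each, which is why the bound is kept only for a
-- single run.
record Runs (s K D n : ℕ) : Set where
  constructor runs
  field
    number  : ℕ
    number≤ : number ≤ K
    weight  : n ≡ number * D
    single  : number ≡ 1 → D ≤ s + s

module _ {s D : ℕ} where

  no-runs : ∀ {K} → Runs s K D 0
  no-runs = runs 0 z≤n refl λ ()

  one-run : D ≤ s + s → Runs s 1 D D
  one-run D≤2s = runs 1 ≤-refl (sym (*-identityˡ D)) λ _ → D≤2s

  runs-weaken : ∀ {K L n} → K ≤ L → Runs s K D n → Runs s L D n
  runs-weaken K≤L (runs m m≤K weight single) = runs m (≤-trans m≤K K≤L) weight single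

  runs-+ : ∀ {K L a b} → Runs s K D a → Runs s L D b → Runs s (K + L) D (a + b)
  runs-+ (runs m m≤K a≡mD single) (runs m′ m′≤L b≡m′D single′) =
    runs (m + m′) (+-mono-≤ m≤K m′≤L) (trans (cong₂ _+_ a≡mD b≡m′D) (sym (*-distribʳ-+ D m m′))) (one-of m single single′)
    where
    one-of : ∀ m {m′} → (m ≡ 1 → D ≤ s + s) → (m′ ≡ 1 → D ≤ s + s) → m + m′ ≡ 1 → D ≤ s + s
    one-of zero          _ single′ m′≡1 = single′ m′≡1
    one-of (suc zero)    single _ _     = single refl
    one-of (suc (suc _)) _ _ ()

  runs-sum : ∀ {K} {A : Set} (f : A → ℕ) → (∀ a → Runs s K D (f a)) → ∀ as → Runs s (length as * K) D (sum (map f as))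
  runs-sum f runs-of []       = no-runs
  runs-sum f runs-of (a ∷ as) = runs-+ (runs-of a) (runs-sum f runs-of as)

copies-admits : ∀ {s G K} m (B : Blowup s G) → Admits B (Runs s K) → Admits (copies-blowup m B) (Runs s (m * K))
copies-admits {s} {K = K} m B admits D x bounded balanced =
  subst₂ (λ M n → Runs s (M * K) D n) (length-tabulate {n = m} id) (sym (sum-cartesianProduct x (allFin m) blocks))
    (runs-sum (λ k → total (x ∘ (k ,_))) per-copy (allFin m))
  where
  open Blowup B
  per-copy : ∀ k → Runs s K D (total (x ∘ (k ,_)))
  per-copy k = admits D (x ∘ (k ,_)) (bounded ∘ (k ,_)) (balanced-∘ x (k ,_) neighbours (balanced ∘ (k ,_)))

_⊕_ : (Φ Ψ : ℕ → ℕ → Set) → ℕ → ℕ → Set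
(Φ ⊕ Ψ) D n = ∃₂ λ a b → n ≡ a + b × Φ D a × Ψ D b

⊔-admits : ∀ {s G H Φ Ψ} (B : Blowup s G) (C : Blowup s H) → Admits B Φ → Admits C Ψ → Admits (⊔-blowup B C) (Φ ⊕ Ψ)
⊔-admits B C admits₁ admits₂ D x bounded balanced =
  _ , _ , total-split ,
  admits₁ D (x ∘ inj₁) (bounded ∘ inj₁) (balanced-∘ x inj₁ B.neighbours (balanced ∘ inj₁)) ,
  admits₂ D (x ∘ inj₂) (bounded ∘ inj₂) (balanced-∘ x inj₂ C.neighbours (balanced ∘ inj₂))
  where
  module B = Blowup B
  module C = Blowup C
  total-split : sum (map x (map inj₁ B.blocks ++ map inj₂ C.blocks)) ≡ B.total (x ∘ inj₁) + C.total (x ∘ inj₂)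
  total-split = begin
    sum (map x (map inj₁ B.blocks ++ map inj₂ C.blocks))
      ≡⟨ cong sum (map-++ x (map inj₁ B.blocks) (map inj₂ C.blocks)) ⟩
    sum (map x (map inj₁ B.blocks) ++ map x (map inj₂ C.blocks))
      ≡⟨ sum-++ (map x (map inj₁ B.blocks)) (map x (map inj₂ C.blocks)) ⟩
    sum (map x (map inj₁ B.blocks)) + sum (map x (map inj₂ C.blocks))
      ≡⟨ cong₂ _+_ (sum-map-∘ x inj₁ B.blocks) (sum-map-∘ x inj₂ C.blocks) ⟩
    B.total (x ∘ inj₁) + C.total (x ∘ inj₂) ∎
    where open ≡-Reasoning

-- Weight sequences along paths and cycles

∑ : ℕ → (ℕ → ℕ) → ℕ
∑ n f = sum (applyUpTo f n)

∑-cong : ∀ n {f g : ℕ → ℕ} → (∀ i → f i ≡ g i) → ∑ n f ≡ ∑ n g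
∑-cong zero    f≗g = refl
∑-cong (suc n) f≗g = cong₂ _+_ (f≗g 0) (∑-cong n (f≗g ∘ suc))

∑-+ : ∀ m n (f : ℕ → ℕ) → ∑ (m + n) f ≡ ∑ m f + ∑ n (f ∘ (m +_))
∑-+ zero    n f = refl
∑-+ (suc m) n f = trans (cong (f 0 +_) (∑-+ m n (f ∘ suc))) (sym (+-assoc (f 0) _ _))

∑-snoc : ∀ n (f : ℕ → ℕ) → ∑ (suc n) f ≡ ∑ n f + f n
∑-snoc n f = begin
  ∑ (1 + n) f             ≡⟨ cong (λ m → ∑ m f) (+-comm 1 n) ⟩
  ∑ (n + 1) f             ≡⟨ ∑-+ n 1 f ⟩
  ∑ n f + (f (n + 0) + 0) ≡⟨ cong (∑ n f +_) (trans (+-identityʳ _) (cong f (+-identityʳ n))) ⟩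
  ∑ n f + f n             ∎
  where open ≡-Reasoning

∑-shift : ∀ n (f : ℕ → ℕ) → f n ≡ f 0 → ∑ n (f ∘ suc) ≡ ∑ n f
∑-shift n f fₙ≡f₀ = +-cancelˡ-≡ (f 0) _ _ (begin
  f 0 + ∑ n (f ∘ suc) ≡⟨ ∑-snoc n f ⟩
  ∑ n f + f n         ≡⟨ cong (∑ n f +_) fₙ≡f₀ ⟩
  ∑ n f + f 0         ≡⟨ +-comm (∑ n f) (f 0) ⟩
  f 0 + ∑ n f         ∎)
  where open ≡-Reasoning

Periodic : ℕ → (ℕ → ℕ) → Set
Periodic r w = ∀ n → w (r + n) ≡ w n

module _ {r : ℕ} {w : ℕ → ℕ} (periodic : Periodic r w) where

  ∑-rotate : ∀ k → ∑ r (w ∘ (_+ k)) ≡ ∑ r w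
  ∑-rotate zero    = ∑-cong r (λ i → cong w (+-identityʳ i))
  ∑-rotate (suc k) = begin
    ∑ r (w ∘ (_+ suc k))       ≡⟨ ∑-cong r (λ i → cong w (+-suc i k)) ⟩
    ∑ r (w ∘ (_+ k) ∘ suc)     ≡⟨ ∑-shift r (w ∘ (_+ k)) (periodic k) ⟩
    ∑ r (w ∘ (_+ k))           ≡⟨ ∑-rotate k ⟩
    ∑ r w                      ∎
    where open ≡-Reasoning

  ∑-periodic : ∀ q → ∑ (q * r) w ≡ q * ∑ r w
  ∑-periodic zero    = refl
  ∑-periodic (suc q) = begin
    ∑ (r + q * r) w                ≡⟨ ∑-+ r (q * r) w ⟩
    ∑ r w + ∑ (q * r) (w ∘ (r +_)) ≡⟨ cong (∑ r w +_) (∑-cong (q * r) periodic) ⟩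
    ∑ r w + ∑ (q * r) w            ≡⟨ cong (∑ r w +_) (∑-periodic q) ⟩
    ∑ r w + q * ∑ r w              ∎
    where open ≡-Reasoning

∑-triples : ∀ {D} (w : ℕ → ℕ) → (∀ n → w n + (w (suc n) + w (suc (suc n))) ≡ D) → ∀ k → ∑ (k * 3) w ≡ k * D
∑-triples     w triple zero    = refl
∑-triples {D} w triple (suc k) = begin
  ∑ (3 + k * 3) w                ≡⟨ ∑-+ 3 (k * 3) w ⟩
  ∑ 3 w + ∑ (k * 3) (w ∘ (3 +_)) ≡⟨ cong₂ _+_ first-triple (∑-triples (w ∘ (3 +_)) (triple ∘ (3 +_)) k) ⟩
  D + k * D                      ∎
  where
  open ≡-Reasoning
  first-triple : ∑ 3 w ≡ D
  first-triple = trans (cong (λ c → w 0 + (w 1 + c)) (+-identityʳ (w 2))) (triple 0)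

BalancedSeq : ℕ → (ℕ → ℕ) → Set
BalancedSeq D w = ∀ n → w (suc n) ≡ 0 ⊎ w n + (w (suc n) + w (suc (suc n))) ≡ D

-- Runs have length at most two: for three consecutive occupied positions after an empty one,
-- the equations at the first two give w 1 + w 2 = D = w 1 + w 2 + w 3.
path-runs : ∀ {s D} n (w : ℕ → ℕ) → BalancedSeq D w → (∀ i → w i ≤ s) → w 0 ≡ 0 → w (suc n) ≡ 0 →
            Runs s ⌊ suc n /2⌋ D (∑ n (w ∘ suc))
path-runs zero    w balanced bounded w₀≡0 end = no-runs
path-runs {s} {D} (suc n) w balanced bounded w₀≡0 end with balanced 0 | balanced 1
... | inj₁ w₁≡0 | _ =
  subst (λ a → Runs s ⌊ 2 + n /2⌋ D (a + ∑ n (w ∘ (2 +_)))) (sym w₁≡0)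
    (runs-weaken (⌊n/2⌋-mono (n≤1+n (suc n))) (path-runs n (w ∘ suc) (balanced ∘ suc) (bounded ∘ suc) w₁≡0 end))
... | inj₂ run₀ | inj₁ w₂≡0 = single n end
  where
  w₁≡D : w 1 ≡ D
  w₁≡D = trans (sym (+-identityʳ (w 1))) (subst₂ (λ a c → a + (w 1 + c) ≡ D) w₀≡0 w₂≡0 run₀)
  D≤2s : D ≤ s + s
  D≤2s = ≤-trans (subst (_≤ s) w₁≡D (bounded 1)) (m≤m+n s s)
  single : ∀ n → w (2 + n) ≡ 0 → Runs s ⌊ 2 + n /2⌋ D (∑ (suc n) (w ∘ suc))
  single zero    _   = subst (Runs s 1 D) (sym (trans (+-identityʳ (w 1)) w₁≡D)) (one-run D≤2s)
  single (suc n) end =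
    subst (Runs s _ D) (sym (cong₂ _+_ w₁≡D (cong (_+ ∑ n (w ∘ (3 +_))) w₂≡0)))
      (runs-+ (one-run D≤2s) (path-runs n (w ∘ (2 +_)) (balanced ∘ (2 +_)) (bounded ∘ (2 +_)) w₂≡0 end))
... | inj₂ run₀ | inj₂ run₁ = double n end
  where
  pair≡D : w 1 + w 2 ≡ D
  pair≡D = subst (λ a → a + (w 1 + w 2) ≡ D) w₀≡0 run₀
  w₃≡0 : w 3 ≡ 0
  w₃≡0 = +-cancelˡ-≡ (w 1 + w 2) (w 3) 0
    (trans (+-assoc (w 1) (w 2) (w 3)) (trans run₁ (trans (sym pair≡D) (sym (+-identityʳ _)))))
  D≤2s : D ≤ s + s
  D≤2s = subst (_≤ s + s) pair≡D (+-mono-≤ (bounded 1) (bounded 2))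
  double : ∀ n → w (2 + n) ≡ 0 → Runs s ⌊ 2 + n /2⌋ D (∑ (suc n) (w ∘ suc))
  double zero          w₂≡0 = subst (Runs s 1 D) (sym (trans (cong (w 1 +_) (sym w₂≡0)) pair≡D)) (one-run D≤2s)
  double (suc zero)    _    = subst (Runs s 1 D) (sym (trans (cong (w 1 +_) (+-identityʳ (w 2))) pair≡D)) (one-run D≤2s)
  double (suc (suc n)) end  =
    subst (Runs s _ D) (sym (trans (sym (+-assoc (w 1) (w 2) _)) (cong₂ _+_ pair≡D (cong (_+ ∑ n (w ∘ (4 +_))) w₃≡0))))
      (runs-+ (one-run D≤2s) (runs-weaken (⌊n/2⌋-mono (n≤1+n (suc n)))
        (path-runs n (w ∘ (3 +_)) (balanced ∘ (3 +_)) (bounded ∘ (3 +_)) w₃≡0 end)))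

cycle-runs : ∀ {s D} r (w : ℕ → ℕ) → Periodic r w → BalancedSeq D w → (∀ i → w i ≤ s) →
             ∀ k → w k ≡ 0 → Runs s ⌊ r /2⌋ D (∑ r w)
cycle-runs zero    w periodic balanced bounded k wₖ≡0 = no-runs
cycle-runs (suc n) w periodic balanced bounded k wₖ≡0 =
  subst (Runs _ _ _) (trans (cong (_+ ∑ n (w ∘ (_+ k) ∘ suc)) (sym wₖ≡0)) (∑-rotate periodic k))
    (path-runs n (w ∘ (_+ k)) (balanced ∘ (_+ k)) (bounded ∘ (_+ k)) wₖ≡0 (trans (periodic k) wₖ≡0))

-- Three periods are both three copies of the cycle and r consecutive triples.
saturated-cycle : ∀ {D} r (w : ℕ → ℕ) → Periodic r w → BalancedSeq D w → (∀ i → w i ≢ 0) → 3 * ∑ r w ≡ r * D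
saturated-cycle {D} r w periodic balanced positive = begin
  3 * ∑ r w   ≡⟨ ∑-periodic periodic 3 ⟨
  ∑ (3 * r) w ≡⟨ cong (λ n → ∑ n w) (*-comm 3 r) ⟩
  ∑ (r * 3) w ≡⟨ ∑-triples w triple r ⟩
  r * D       ∎
  where
  open ≡-Reasoning
  triple : ∀ n → w n + (w (suc n) + w (suc (suc n))) ≡ D
  triple n = [ ⊥-elim ∘ positive (suc n) , id ] (balanced n)

module _ (r : ℕ) .{{_ : NonZero r}} where

  mod-cong : ∀ {m n} → m % r ≡ n % r → m mod r ≡ n mod r
  mod-cong {m} {n} eq = fromℕ<-cong (m % r) (n % r) eq (m%n<n m r) (m%n<n n r)

  toℕ-mod : ∀ (i : Fin r) → toℕ i mod r ≡ i
  toℕ-mod i = toℕ-injective (trans (toℕ-fromℕ< (m%n<n (toℕ i) r)) (m<n⇒m%n≡m (toℕ<n i)))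

  mod-periodic : ∀ n → (r + n) mod r ≡ n mod r
  mod-periodic n = mod-cong (trans (cong (_% r) (+-comm r n)) ([m+n]%n≡m%n n r))

  toℕ-mod-+ : ∀ m k → (toℕ (m mod r) + k) mod r ≡ (m + k) mod r
  toℕ-mod-+ m k = mod-cong (begin
    (toℕ (m mod r) + k) % r      ≡⟨ cong (λ a → (a + k) % r) (toℕ-fromℕ< (m%n<n m r)) ⟩
    (m % r + k) % r              ≡⟨ %-distribˡ-+ (m % r) k r ⟩
    (m % r % r + k % r) % r      ≡⟨ cong (λ a → (a + k % r) % r) (m%n%n≡m%n m r) ⟩
    (m % r + k % r) % r          ≡⟨ %-distribˡ-+ m k r ⟨
    (m + k) % r                  ∎)
    where open ≡-Reasoning

  pred-neighbour : ∀ n → (toℕ (suc n mod r) + (r ∸ 1)) mod r ≡ n mod r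
  pred-neighbour n = begin
    (toℕ (suc n mod r) + (r ∸ 1)) mod r ≡⟨ toℕ-mod-+ (suc n) (r ∸ 1) ⟩
    (suc n + (r ∸ 1)) mod r             ≡⟨ cong (_mod r) (+-suc n (r ∸ 1)) ⟨
    (n + suc (r ∸ 1)) mod r             ≡⟨ cong (λ m → (n + m) mod r) (suc-pred r) ⟩
    (n + r) mod r                       ≡⟨ cong (_mod r) (+-comm n r) ⟩
    (r + n) mod r                       ≡⟨ mod-periodic n ⟩
    n mod r                             ∎
    where open ≡-Reasoning

  succ-neighbour : ∀ n → (toℕ (suc n mod r) + 1) mod r ≡ suc (suc n) mod r
  succ-neighbour n = trans (toℕ-mod-+ (suc n) 1) (cong (_mod r) (+-comm (suc n) 1))

  cycleNeighbours : Fin r → List (Fin r)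
  cycleNeighbours i = (toℕ i + (r ∸ 1)) mod r ∷ (toℕ i + 1) mod r ∷ []

  cycleBlocks : List (Fin r)
  cycleBlocks = applyUpTo (_mod r) r

  -- True for every r ≥ 3; for the cycles used here it is checked by evaluation.
  CycleStructure : Set
  CycleStructure = (∀ i j → CycleAdj r i j ⇔ j ∈ cycleNeighbours i) × (∀ i → Unique (cycleNeighbours i)) ×
                   (∀ i → i ∉ cycleNeighbours i) × Unique cycleBlocks × (∀ i → i ∈ cycleBlocks)

  cycleStructure? : Dec CycleStructure
  cycleStructure? =
    all? (λ i → all? (λ j → cycleAdj? r i j ⇔? (j ∈? cycleNeighbours i))) ×-dec
    all? (unique? ∘ cycleNeighbours) ×-dec
    all? (λ i → i ∉? cycleNeighbours i) ×-dec
    unique? cycleBlocks ×-dec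
    all? (_∈? cycleBlocks)
    where
    open import Data.List.Membership.DecPropositional _≟ᶠ_ using (_∈?_; _∉?_)
    open import Data.List.Relation.Unary.Unique.DecPropositional _≟ᶠ_ using (unique?)
    _⇔?_ : {A B : Set} → Dec A → Dec B → Dec (A ⇔ B)
    a? ⇔? b? = map′ (λ (f , g) → mk⇔ f g) (λ A⇔B → Equivalence.to A⇔B , Equivalence.from A⇔B)
                    ((a? →-dec b?) ×-dec (b? →-dec a?))

cycle-blowup : ∀ {s} r .{{_ : NonZero r}} → CycleStructure r → Blowup s (CK r s)
cycle-blowup {s} r (adj⇔N , N-unique , ∉N , blocks-unique , ∈-blocks) = record
  { Block                = Fin r
  ; _≟ᴮ_                 = _≟ᶠ_
  ; _≟ⱽ_                 = ×.≡-dec _≟ᶠ_ _≟ᶠ_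
  ; block                = proj₁
  ; slot                 = proj₂
  ; block-slot-injective = cong₂ _,_
  ; neighbours           = cycleNeighbours r
  ; neighbours-unique    = N-unique
  ; ∉-neighbours         = ∉N
  ; blocks               = cycleBlocks r
  ; blocks-unique        = blocks-unique
  ; ∈-blocks             = ∈-blocks
  ; adj⇔                 = λ (i , a) (j , b) → mk⇔
      (Sum.map (Product.map sym (λ a≢b → a≢b ∘ sym ∘ ×.,-injectiveʳ)) (Equivalence.to (adj⇔N i j)))
      (Sum.map (λ (j≡i , ne) → sym j≡i , ne ∘ cong₂ _,_ j≡i ∘ sym) (Equivalence.from (adj⇔N i j)))
  }

cycle-admits : ∀ {s} r .{{_ : NonZero r}} (structure : CycleStructure r) →
               Admits (cycle-blowup {s} r structure) (λ D n → Runs s ⌊ r /2⌋ D n ⊎ 3 * n ≡ r * D)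
cycle-admits {s} r structure D x bounded balanced = split (any? (λ i → x i ≟ 0))
  where
  w : ℕ → ℕ
  w = x ∘ (_mod r)
  periodic : Periodic r w
  periodic = cong x ∘ mod-periodic r
  balancedSeq : BalancedSeq D w
  balancedSeq n = Sum.map id rearrange (balanced (suc n mod r))
    where
    rearrange : w (suc n) + (x ((toℕ (suc n mod r) + (r ∸ 1)) mod r) + (x ((toℕ (suc n mod r) + 1) mod r) + 0)) ≡ D →
                w n + (w (suc n) + w (suc (suc n))) ≡ D
    rearrange eq rewrite pred-neighbour r n | succ-neighbour r n | +-identityʳ (w (suc (suc n))) =
      trans (x∙yz≈y∙xz (w n) (w (suc n)) (w (suc (suc n)))) eq
  ∑≡total : ∑ r w ≡ sum (map x (cycleBlocks r))
  ∑≡total = cong sum (sym (map-applyUpTo (_mod r) x r))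
  split : Dec (∃ λ i → x i ≡ 0) →
          Runs s ⌊ r /2⌋ D (sum (map x (cycleBlocks r))) ⊎ 3 * sum (map x (cycleBlocks r)) ≡ r * D
  split (yes (i , xᵢ≡0)) = inj₁ (subst (Runs s ⌊ r /2⌋ D) ∑≡total
    (cycle-runs r w periodic balancedSeq (bounded ∘ (_mod r)) (toℕ i) (trans (cong x (toℕ-mod r i)) xᵢ≡0)))
  split (no none) = inj₂ (subst (λ n → 3 * n ≡ r * D) ∑≡total
    (saturated-cycle r w periodic balancedSeq (λ n wₙ≡0 → none (n mod r , wₙ≡0))))

nonagon : CycleStructure 9
nonagon = toWitness {a? = cycleStructure? 9} _

pentagon : CycleStructure 5
pentagon = toWitness {a? = cycleStructure? 5} _

square : CycleStructure 4
square = toWitness {a? = cycleStructure? 4} _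

nonagon-blowup : ∀ {s} → Blowup s (CK 9 s)
nonagon-blowup = cycle-blowup 9 nonagon

nonagon-admits : ∀ {s} → Admits (nonagon-blowup {s}) (Runs s 4)
nonagon-admits {s} D x bounded balanced = [ id , saturated⇒runs ]′ (cycle-admits 9 nonagon D x bounded balanced)
  where
  saturated⇒runs : ∀ {n} → 3 * n ≡ 9 * D → Runs s 4 D n
  saturated⇒runs 3n≡9D = runs 3 (s≤s (s≤s (s≤s z≤n))) (*-cancelˡ-≡ _ _ 3 (trans 3n≡9D (*-assoc 3 3 D))) λ ()

-- Arithmetic of the four cases

prime-¬runs : ∀ {p s K D} → Prime p → K < p → s + s < p → ¬ Runs s K D p
prime-¬runs {p} p-prime K<p 2s<p (runs m m≤K p≡mD single) with prime⇒irreducible p-prime (divides m p≡mD)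
... | inj₁ refl = <-irrefl (sym (trans p≡mD (*-identityʳ m))) (≤-<-trans m≤K K<p)
... | inj₂ refl = <-irrefl refl (≤-<-trans (single m≡1) 2s<p)
  where
  instance _ = prime⇒nonZero p-prime
  m≡1 : m ≡ 1
  m≡1 = *-cancelʳ-≡ m 1 p (trans (sym p≡mD) (sym (+-identityʳ p)))

prime-¬saturated : ∀ {p r a M D} → Prime p → ¬ 3 ∣ r → 1 < r → p % 3 ≢ r % 3 → 3 * a ≡ r * D → p ≢ a + M * D
prime-¬saturated {p} {r} {a} {M} {D} p-prime 3∤r 1<r p≢r 3a≡rD p≡a+MD =
  [ (λ r+3M≡1 → <-irrefl (sym r+3M≡1) (≤-trans 1<r (m≤m+n r (M * 3))))
  , (λ r+3M≡p → p≢r (trans (cong (_% 3) (sym r+3M≡p)) ([m+kn]%n≡m%n r M 3)))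
  ]′ (prime⇒irreducible p-prime (divides c p≡c*[r+3M]))
  where
  3∣D : 3 ∣ D
  3∣D = [ ⊥-elim ∘ 3∤r , id ]′ (euclidsLemma r D (toWitness {a? = prime? 3} _) (divides a (trans (sym 3a≡rD) (*-comm 3 a))))
  open _∣_ 3∣D renaming (quotient to c; equality to D≡c*3)
  regroup : ∀ r c → r * (c * 3) ≡ 3 * (r * c)
  regroup = solve-∀
  factor : ∀ r c M → r * c + M * (c * 3) ≡ c * (r + M * 3)
  factor = solve-∀
  a≡rc : a ≡ r * c
  a≡rc = *-cancelˡ-≡ a (r * c) 3 (trans 3a≡rD (trans (cong (r *_) D≡c*3) (regroup r c)))
  p≡c*[r+3M] : p ≡ c * (r + M * 3)
  p≡c*[r+3M] = trans p≡a+MD (trans (cong₂ (λ a D → a + M * D) a≡rc D≡c*3) (factor r c M))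

nonagons-¬regular : ∀ {p} m s → Prime p → m * 4 < p → s + s < p → ¬ HasInducedRegularSubgraph (copies m (CK 9 s)) p
nonagons-¬regular m s p-prime K<p 2s<p =
  prime-¬runs p-prime K<p 2s<p ∘ proj₂ ∘
  regular-size {Φ = Runs s (m * 4)} (copies-blowup m nonagon-blowup) (copies-admits m nonagon-blowup nonagon-admits)

cycle⊔nonagons-¬regular : ∀ {p} r .{{_ : NonZero r}} → CycleStructure r → ∀ m s → Prime p →
                          ¬ 3 ∣ r → 1 < r → p % 3 ≢ r % 3 → ⌊ r /2⌋ + m * 4 < p → s + s < p →
                          ¬ HasInducedRegularSubgraph (CK r s ⊔ copies m (CK 9 s)) p
cycle⊔nonagons-¬regular {p} r structure m s p-prime 3∤r 1<r p≢r K<p 2s<p =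
  impossible ∘
  regular-size {Φ = Φ} (⊔-blowup cycle nonagons)
    (⊔-admits cycle nonagons (cycle-admits r structure) (copies-admits m nonagon-blowup nonagon-admits))
  where
  cycle : Blowup s (CK r s)
  cycle = cycle-blowup r structure
  nonagons : Blowup s (copies m (CK 9 s))
  nonagons = copies-blowup m nonagon-blowup
  Φ : ℕ → ℕ → Set
  Φ = (λ D n → Runs s ⌊ r /2⌋ D n ⊎ 3 * n ≡ r * D) ⊕ Runs s (m * 4)
  impossible : ¬ ∃ λ D → Φ D p
  impossible (D , a , b , p≡a+b , inj₁ few , few′) =
    prime-¬runs p-prime K<p 2s<p (subst (Runs s _ D) (sym p≡a+b) (runs-+ few few′))
  impossible (D , a , b , p≡a+b , inj₂ saturated , runs M _ b≡MD _) =
    prime-¬saturated {a = a} {M} p-prime 3∤r 1<r p≢r saturated (trans p≡a+b (cong (a +_) b≡MD))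

[12t+c]%3≢r%3 : ∀ t c r → c % 3 ≢ r % 3 → (12 * t + c) % 3 ≢ r % 3
[12t+c]%3≢r%3 t c r c≢r = c≢r ∘ trans (sym (trans (cong (_% 3) (regroup t c)) ([m+kn]%n≡m%n c (4 * t) 3)))
  where
  regroup : ∀ t c → 12 * t + c ≡ c + 4 * t * 3
  regroup = solve-∀

theorem7 : (p t : ℕ) → Prime p → 5 ≤ p →
    ((p ≡ 12 * t + 1) → ¬ HasInducedRegularSubgraph (copies (3 * t) (CK 9 (6 * t))) p)
    × ((p ≡ 12 * t + 5) → ¬ HasInducedRegularSubgraph (copies (3 * t + 1) (CK 9 (6 * t + 2))) p)
    × ((p ≡ 12 * t + 7) → ¬ HasInducedRegularSubgraph (CK 5 (6 * t + 3) ⊔ copies (3 * t + 1) (CK 9 (6 * t + 3))) p)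
    × ((p ≡ 12 * t + 11) → ¬ HasInducedRegularSubgraph (CK 4 (6 * t + 5) ⊔ copies (3 * t + 2) (CK 9 (6 * t + 5))) p)
theorem7 p t p-prime _ =
    (λ { refl → nonagons-¬regular (3 * t) (6 * t) p-prime (≤-reflexive (runs₁ t)) (≤-reflexive (cliques₁ t)) })
  , (λ { refl → nonagons-¬regular (3 * t + 1) (6 * t + 2) p-prime (≤-reflexive (runs₅ t)) (≤-reflexive (cliques₅ t)) })
  , (λ { refl → cycle⊔nonagons-¬regular 5 pentagon (3 * t + 1) (6 * t + 3) p-prime (toWitnessFalse {a? = 3 ∣? 5} _)
                  (s≤s (s≤s z≤n)) ([12t+c]%3≢r%3 t 7 5 λ ()) (≤-reflexive (runs₇ t)) (≤-reflexive (cliques₇ t)) })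
  , (λ { refl → cycle⊔nonagons-¬regular 4 square (3 * t + 2) (6 * t + 5) p-prime (toWitnessFalse {a? = 3 ∣? 4} _)
                  (s≤s (s≤s z≤n)) ([12t+c]%3≢r%3 t 11 4 λ ()) (≤-reflexive (runs₁₁ t)) (≤-reflexive (cliques₁₁ t)) })
  where
  runs₁ : ∀ t → suc (3 * t * 4) ≡ 12 * t + 1
  runs₁ = solve-∀
  cliques₁ : ∀ t → suc (6 * t + 6 * t) ≡ 12 * t + 1
  cliques₁ = solve-∀
  runs₅ : ∀ t → suc ((3 * t + 1) * 4) ≡ 12 * t + 5
  runs₅ = solve-∀
  cliques₅ : ∀ t → suc ((6 * t + 2) + (6 * t + 2)) ≡ 12 * t + 5
  cliques₅ = solve-∀
  runs₇ : ∀ t → suc (2 + (3 * t + 1) * 4) ≡ 12 * t + 7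
  runs₇ = solve-∀
  cliques₇ : ∀ t → suc ((6 * t + 3) + (6 * t + 3)) ≡ 12 * t + 7
  cliques₇ = solve-∀
  runs₁₁ : ∀ t → suc (2 + (3 * t + 2) * 4) ≡ 12 * t + 11
  runs₁₁ = solve-∀
  cliques₁₁ : ∀ t → suc ((6 * t + 5) + (6 * t + 5)) ≡ 12 * t + 11
  cliques₁₁ = solve-∀
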